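{- Let $H$ be a (not necessarily finite) Heyting algebra, let $\mathcal{C}_H=\{x\in H : x\vee\neg x=\top\}$ denote the center of $H$, let $\mathbf{S}\subseteq H$ denote the set of non-central elements of $H$ (those $x$ with $x\vee\neg x\neq\top$), and take any maximal element $\sigma\in\mathbf{S}$ (i.e. for any $s'\in\mathbf{S}$, if $\sigma\le s'$ then $\sigma=s'$). The map $f:\mathcal{C}_H\to\mathbf{S}$ given by $$f(x)=\begin{cases}\sigma\wedge x & \text{if } \sigma\vee x=\top,\\ \sigma\wedge\neg x & \text{otherwise}\end{cases}$$ is well-defined and two-to-one.
   Context: A Heyting algebra is a bounded distributive lattice $\langle H,\wedge,\vee,\rightarrow,\bot,\top\rangle$ in which $a\rightarrow b$ is the maximum of $\{c : a\wedge c\le b\}$; $\neg x$ abbreviates $x\rightarrow\bot$. -}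

module Defs where

open import Level using (_⊔_)
open import Relation.Binary.Lattice.Bundles using (HeytingAlgebra)
open import Relation.Nullary using (¬_; Dec; yes; no)
open import Data.Product using (Σ; _×_)
open import Data.Sum using (_⊎_)

module HA {c ℓ₁ ℓ₂} (H : HeytingAlgebra c ℓ₁ ℓ₂) where
  open HeytingAlgebra H

  neg : Carrier → Carrier
  neg x = x ⇨ ⊥

  Central : Carrier → Set ℓ₁
  Central x = (x ∨ neg x) ≈ ⊤

  NonCentral : Carrier → Set ℓ₁
  NonCentral x = ¬ ((x ∨ neg x) ≈ ⊤)

  MaximalNonCentral : Carrier → Set (c ⊔ ℓ₁ ⊔ ℓ₂)
  MaximalNonCentral σ = NonCentral σ × (∀ s′ → NonCentral s′ → σ ≤ s′ → σ ≈ s′)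

  -- the map f, given a decision of the case condition σ ∨ x = ⊤
  -- (the paper's case split is classical; the decision is supplied by excluded middle)
  f : (σ : Carrier) → (∀ x → Dec ((σ ∨ x) ≈ ⊤)) → Carrier → Carrier
  f σ dec x with dec x
  ... | yes _ = σ ∧ x
  ... | no  _ = σ ∧ neg x

  TwoToOne : (Carrier → Carrier) → Set (c ⊔ ℓ₁)
  TwoToOne g = ∀ x → Central x →
    Σ Carrier λ y → Central y × ¬ (y ≈ x) × (g y ≈ g x) ×
      (∀ z → Central z → g z ≈ g x → (z ≈ x) ⊎ (z ≈ y))

-- Maximality of σ forces x ≤ σ or ¬x ≤ σ for every x: otherwise σ ∨ x and σ ∨ ¬x are
-- both central, and so is their meet σ. For central x the two cannot hold together, since
-- then ⊤ = x ∨ ¬x ≤ σ, and the case condition σ ∨ x = ⊤ says exactly ¬x ≤ σ. Hence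
-- f x = σ ∧ k for the one k of x, ¬x with ¬k ≤ σ, and f x = f ¬x. As σ = (σ ∧ k) ∨ ¬k,
-- the element σ ∧ k is non-central and determines k, so the fibre over f x is {x, ¬x}.
module Submission where

open import Defs
open import Level using (Level)
open import Relation.Binary.Lattice.Bundles using (HeytingAlgebra)
open import Axiom.ExcludedMiddle using (ExcludedMiddle)
open import Data.Product using (_×_; _,_; proj₁; proj₂)
open import Data.Sum using (_⊎_; inj₁; inj₂)
open import Data.Empty using (⊥-elim)
open import Relation.Nullary using (¬_; Dec; yes; no; contradiction)
import Relation.Binary.Lattice.Properties.HeytingAlgebra as HeytingProperties
import Relation.Binary.Lattice.Properties.DistributiveLattice as DistributiveProperties
import Relation.Binary.Lattice.Properties.JoinSemilattice as JoinProperties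
import Relation.Binary.Lattice.Properties.MeetSemilattice as MeetProperties

module CentralElements {c ℓ₁ ℓ₂} (H : HeytingAlgebra c ℓ₁ ℓ₂) where
  open HeytingAlgebra H
  open HA H
  open HeytingProperties H
    using (⇨-eval; x≤¬¬x; ⇨-cong; ∧-distribˡ-∨-≤; de-morgan₁; distributiveLattice)
  open DistributiveProperties distributiveLattice using (∨-distribˡ-∧)
  open JoinProperties joinSemilattice using (∨-cong)
  open MeetProperties meetSemilattice using (∧-cong; ∧-monotonic)

  ≤-neg-absurd : ∀ {w x} → w ≤ x → w ≤ neg x → w ≤ ⊥
  ≤-neg-absurd w≤x w≤¬x = trans (∧-greatest w≤¬x w≤x) ⇨-eval

  Central⇒⊤≤ : ∀ {x} → Central x → ⊤ ≤ x ∨ neg x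
  Central⇒⊤≤ cx = reflexive (Eq.sym cx)

  ⊤≤⇒Central : ∀ {x} → ⊤ ≤ x ∨ neg x → Central x
  ⊤≤⇒Central = antisym (maximum _)

  ≤-by-cases : ∀ {a b y z} → y ≤ a ∨ b → y ∧ a ≤ z → y ∧ b ≤ z → y ≤ z
  ≤-by-cases {a} {b} {y} {z} y≤a∨b y∧a≤z y∧b≤z = begin
    y              ≤⟨ ∧-greatest refl y≤a∨b ⟩
    y ∧ (a ∨ b)    ≤⟨ ∧-distribˡ-∨-≤ y a b ⟩
    y ∧ a ∨ y ∧ b  ≤⟨ ∨-least y∧a≤z y∧b≤z ⟩
    z              ∎
    where open import Relation.Binary.Reasoning.PartialOrder poset

  Central-cases : ∀ {x y z} → Central x → y ∧ x ≤ z → y ∧ neg x ≤ z → y ≤ z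
  Central-cases cx = ≤-by-cases (trans (maximum _) (Central⇒⊤≤ cx))

  Central-resp : ∀ {x y} → x ≈ y → Central x → Central y
  Central-resp x≈y cx = Eq.trans (Eq.sym (∨-cong x≈y (⇨-cong x≈y Eq.refl))) cx

  NonCentral-resp : ∀ {x y} → x ≈ y → NonCentral y → NonCentral x
  NonCentral-resp x≈y ny cx = ny (Central-resp x≈y cx)

  Central-¬¬ : ∀ {x} → Central x → neg (neg x) ≈ x
  Central-¬¬ {x} cx =
    antisym (Central-cases cx (x∧y≤y _ x) (trans ⇨-eval (minimum x))) (x≤¬¬x x)

  Central-neg-swap : ∀ {x y} → Central x → neg x ≈ y → x ≈ neg y
  Central-neg-swap cx ¬x≈y = Eq.trans (Eq.sym (Central-¬¬ cx)) (⇨-cong ¬x≈y Eq.refl)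

  Central-neg : ∀ {x} → Central x → Central (neg x)
  Central-neg {x} cx = ⊤≤⇒Central (Central-cases cx
    (trans (x∧y≤y _ _) (trans (x≤¬¬x x) (y≤x∨y _ _)))
    (trans (x∧y≤y _ _) (x≤x∨y _ _)))

  Central-∨ : ∀ {x y} → Central x → Central y → Central (x ∨ y)
  Central-∨ {x} {y} cx cy = ⊤≤⇒Central (Central-cases cx
    (trans (x∧y≤y _ _) (trans (x≤x∨y x y) (x≤x∨y _ _)))
    (Central-cases cy
      (trans (x∧y≤y _ _) (trans (y≤x∨y x y) (x≤x∨y _ _)))
      (trans (∧-monotonic (x∧y≤y _ _) refl)
        (trans (reflexive (Eq.sym (de-morgan₁ x y))) (y≤x∨y _ _)))))

  Central-∧ : ∀ {x y} → Central x → Central y → Central (x ∧ y)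
  Central-∧ {x} {y} cx cy = Central-resp ¬[¬x∨¬y]≈x∧y
    (Central-neg (Central-∨ (Central-neg cx) (Central-neg cy)))
    where
    ¬[¬x∨¬y]≈x∧y : neg (neg x ∨ neg y) ≈ x ∧ y
    ¬[¬x∨¬y]≈x∧y = Eq.trans (de-morgan₁ (neg x) (neg y)) (∧-cong (Central-¬¬ cx) (Central-¬¬ cy))

  Central-neg≉ : ∀ {x} → ¬ (⊤ ≤ ⊥) → Central x → ¬ (neg x ≈ x)
  Central-neg≉ ⊤≰⊥ cx ¬x≈x = ⊤≰⊥ (trans (Central⇒⊤≤ cx)
    (∨-least (≤-neg-absurd refl (reflexive (Eq.sym ¬x≈x))) (≤-neg-absurd (reflexive ¬x≈x) refl)))

  Central-both-below : ∀ {x s} → Central x → x ≤ s → neg x ≤ s → ⊤ ≤ s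
  Central-both-below cx x≤s ¬x≤s = trans (Central⇒⊤≤ cx) (∨-least x≤s ¬x≤s)

  NonCentral⇒⊤≰ : ∀ {s} → NonCentral s → ¬ (⊤ ≤ s)
  NonCentral⇒⊤≰ ns ⊤≤s = ns (⊤≤⇒Central (trans ⊤≤s (x≤x∨y _ _)))

  ∨≈⊤⇒neg≤ : ∀ {s x} → s ∨ x ≈ ⊤ → neg x ≤ s
  ∨≈⊤⇒neg≤ {s} s∨x≈⊤ =
    ≤-by-cases (trans (maximum _) (reflexive (Eq.sym s∨x≈⊤))) (x∧y≤y _ s) (trans ⇨-eval (minimum s))

  [s∨x]∧[s∨¬x]≈s : ∀ s x → (s ∨ x) ∧ (s ∨ neg x) ≈ s
  [s∨x]∧[s∨¬x]≈s s x = antisym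
    (trans (reflexive (Eq.sym (∨-distribˡ-∧ s x (neg x))))
           (∨-least refl (trans (≤-neg-absurd (x∧y≤x _ _) (x∧y≤y _ _)) (minimum s))))
    (∧-greatest (x≤x∨y s x) (x≤x∨y s (neg x)))

  neg≤⇒∨≈⊤ : ∀ {s x} → Central x → neg x ≤ s → s ∨ x ≈ ⊤
  neg≤⇒∨≈⊤ {s} {x} cx ¬x≤s =
    antisym (maximum _) (trans (Central⇒⊤≤ cx) (∨-least (y≤x∨y s x) (trans ¬x≤s (x≤x∨y s x))))

  ∧-cancelˡ-≤ : ∀ {s a b} → Central b → neg b ≤ s → s ∧ a ≤ s ∧ b → a ≤ b
  ∧-cancelˡ-≤ cb ¬b≤s s∧a≤s∧b = Central-cases cb (x∧y≤y _ _)
    (trans (∧-greatest (trans (x∧y≤y _ _) ¬b≤s) (x∧y≤x _ _)) (trans s∧a≤s∧b (x∧y≤y _ _)))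

  ∧-cancelˡ : ∀ {s a b} → Central a → Central b → neg a ≤ s → neg b ≤ s → s ∧ a ≈ s ∧ b → a ≈ b
  ∧-cancelˡ ca cb ¬a≤s ¬b≤s s∧a≈s∧b =
    antisym (∧-cancelˡ-≤ cb ¬b≤s (reflexive s∧a≈s∧b)) (∧-cancelˡ-≤ ca ¬a≤s (reflexive (Eq.sym s∧a≈s∧b)))

  s≈s∧k∨¬k : ∀ {s k} → Central k → neg k ≤ s → s ≈ s ∧ k ∨ neg k
  s≈s∧k∨¬k ck ¬k≤s = antisym
    (Central-cases ck (x≤x∨y _ _) (trans (x∧y≤y _ _) (y≤x∨y _ _)))
    (∨-least (x∧y≤x _ _) ¬k≤s)

  NonCentral-∧ : ∀ {s k} → NonCentral s → Central k → neg k ≤ s → NonCentral (s ∧ k)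
  NonCentral-∧ ns ck ¬k≤s cs∧k =
    ns (Central-resp (Eq.sym (s≈s∧k∨¬k ck ¬k≤s)) (Central-∨ cs∧k (Central-neg ck)))

  σ∨x≈⊤⇒f≈σ∧x : ∀ {σ} (dec : ∀ x → Dec (σ ∨ x ≈ ⊤)) {x} → σ ∨ x ≈ ⊤ → f σ dec x ≈ σ ∧ x
  σ∨x≈⊤⇒f≈σ∧x dec {x} σ∨x≈⊤ with dec x
  ... | yes _     = Eq.refl
  ... | no σ∨x≉⊤ = contradiction σ∨x≈⊤ σ∨x≉⊤

  σ∨x≉⊤⇒f≈σ∧¬x : ∀ {σ} (dec : ∀ x → Dec (σ ∨ x ≈ ⊤)) {x} → ¬ (σ ∨ x ≈ ⊤) → f σ dec x ≈ σ ∧ neg x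
  σ∨x≉⊤⇒f≈σ∧¬x dec {x} σ∨x≉⊤ with dec x
  ... | yes σ∨x≈⊤ = contradiction σ∨x≈⊤ σ∨x≉⊤
  ... | no _      = Eq.refl

  module MaximalNonCentralElement
    (em : ExcludedMiddle ℓ₁) {σ : Carrier} (maximal : MaximalNonCentral σ) where
    σ-nonCentral : NonCentral σ
    σ-nonCentral = proj₁ maximal

    ⊤≰σ : ¬ (⊤ ≤ σ)
    ⊤≰σ = NonCentral⇒⊤≰ σ-nonCentral

    absorbed : ∀ {y} → NonCentral (σ ∨ y) → y ≤ σ
    absorbed {y} nc = trans (y≤x∨y σ y) (reflexive (Eq.sym (proj₂ maximal (σ ∨ y) nc (x≤x∨y σ y))))

    ≤σ⊎neg≤σ : ∀ x → x ≤ σ ⊎ neg x ≤ σ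
    ≤σ⊎neg≤σ x with em {Central (σ ∨ x)} | em {Central (σ ∨ neg x)}
    ... | no nc  | _      = inj₁ (absorbed nc)
    ... | yes _  | no nc  = inj₂ (absorbed nc)
    ... | yes c₁ | yes c₂ =
      ⊥-elim (σ-nonCentral (Central-resp ([s∨x]∧[s∨¬x]≈s σ x) (Central-∧ c₁ c₂)))

    F : Carrier → Carrier
    F = f σ (λ _ → em)

    F-neg≤σ : ∀ {x} → Central x → neg x ≤ σ → F x ≈ σ ∧ x
    F-neg≤σ cx ¬x≤σ = σ∨x≈⊤⇒f≈σ∧x (λ _ → em) (neg≤⇒∨≈⊤ cx ¬x≤σ)

    F-≤σ : ∀ {x} → Central x → x ≤ σ → F x ≈ σ ∧ neg x
    F-≤σ cx x≤σ = σ∨x≉⊤⇒f≈σ∧¬x (λ _ → em)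
      (λ σ∨x≈⊤ → ⊤≰σ (Central-both-below cx x≤σ (∨≈⊤⇒neg≤ σ∨x≈⊤)))

    ¬¬≤σ : ∀ {x} → Central x → x ≤ σ → neg (neg x) ≤ σ
    ¬¬≤σ cx x≤σ = trans (reflexive (Central-¬¬ cx)) x≤σ

    F-nonCentral : ∀ x → Central x → NonCentral (F x)
    F-nonCentral x cx with ≤σ⊎neg≤σ x
    ... | inj₁ x≤σ  = NonCentral-resp (F-≤σ cx x≤σ)
                        (NonCentral-∧ σ-nonCentral (Central-neg cx) (¬¬≤σ cx x≤σ))
    ... | inj₂ ¬x≤σ = NonCentral-resp (F-neg≤σ cx ¬x≤σ) (NonCentral-∧ σ-nonCentral cx ¬x≤σ)

    F-neg : ∀ {x} → Central x → F (neg x) ≈ F x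
    F-neg {x} cx with ≤σ⊎neg≤σ x
    ... | inj₁ x≤σ  = Eq.trans (F-neg≤σ (Central-neg cx) (¬¬≤σ cx x≤σ)) (Eq.sym (F-≤σ cx x≤σ))
    ... | inj₂ ¬x≤σ = begin
      F (neg x)            ≈⟨ F-≤σ (Central-neg cx) ¬x≤σ ⟩
      σ ∧ neg (neg x)      ≈⟨ ∧-cong Eq.refl (Central-¬¬ cx) ⟩
      σ ∧ x                ≈⟨ F-neg≤σ cx ¬x≤σ ⟨
      F x                  ∎
      where
      open import Relation.Binary.Reasoning.Setoid setoid

    F-fibre : ∀ {x z} → Central x → Central z → F z ≈ F x → z ≈ x ⊎ z ≈ neg x
    F-fibre {x} {z} cx cz Fz≈Fx = cases (≤σ⊎neg≤σ x) (≤σ⊎neg≤σ z)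
      where
      cancel : ∀ {a b} → Central a → Central b → neg a ≤ σ → neg b ≤ σ →
               F z ≈ σ ∧ a → F x ≈ σ ∧ b → a ≈ b
      cancel ca cb ¬a≤σ ¬b≤σ Fz≈σ∧a Fx≈σ∧b =
        ∧-cancelˡ ca cb ¬a≤σ ¬b≤σ (Eq.trans (Eq.sym Fz≈σ∧a) (Eq.trans Fz≈Fx Fx≈σ∧b))

      cases : x ≤ σ ⊎ neg x ≤ σ → z ≤ σ ⊎ neg z ≤ σ → z ≈ x ⊎ z ≈ neg x
      cases (inj₂ ¬x≤σ) (inj₂ ¬z≤σ) =
        inj₁ (cancel cz cx ¬z≤σ ¬x≤σ (F-neg≤σ cz ¬z≤σ) (F-neg≤σ cx ¬x≤σ))
      cases (inj₁ x≤σ) (inj₂ ¬z≤σ) =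
        inj₂ (cancel cz (Central-neg cx) ¬z≤σ (¬¬≤σ cx x≤σ) (F-neg≤σ cz ¬z≤σ) (F-≤σ cx x≤σ))
      cases (inj₂ ¬x≤σ) (inj₁ z≤σ) = inj₂ (Central-neg-swap cz
        (cancel (Central-neg cz) cx (¬¬≤σ cz z≤σ) ¬x≤σ (F-≤σ cz z≤σ) (F-neg≤σ cx ¬x≤σ)))
      cases (inj₁ x≤σ) (inj₁ z≤σ) = inj₁ (Eq.trans
        (Central-neg-swap cz (cancel (Central-neg cz) (Central-neg cx)
          (¬¬≤σ cz z≤σ) (¬¬≤σ cx x≤σ) (F-≤σ cz z≤σ) (F-≤σ cx x≤σ)))
        (Central-¬¬ cx))

    F-twoToOne : TwoToOne F
    F-twoToOne x cx =
      neg x , Central-neg cx , Central-neg≉ ⊤≰⊥ cx , F-neg cx , λ z cz → F-fibre cx cz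
      where
      ⊤≰⊥ : ¬ (⊤ ≤ ⊥)
      ⊤≰⊥ ⊤≤⊥ = ⊤≰σ (trans ⊤≤⊥ (minimum σ))

theorem4p8 : ∀ {c ℓ₁ ℓ₂ : Level} → (em : ExcludedMiddle ℓ₁) → (H : HeytingAlgebra c ℓ₁ ℓ₂) →
    let open HeytingAlgebra H
        open HA H
    in (σ : Carrier) → MaximalNonCentral σ →
       (∀ x → Central x → NonCentral (f σ (λ x → em) x)) × TwoToOne (f σ (λ x → em))
theorem4p8 em H σ maximal = F-nonCentral , F-twoToOne
  where open CentralElements.MaximalNonCentralElement H em maximal
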